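{- Let $r\ge3$ be an integer and let $\mathscr C$ be a class of graphs with sub-exponential expansion. Let $g$ be a function such that, for every integer $p$, every graph in $\mathscr C$ with girth at least $g(p)$ is $p$-path degenerate. Then every graph $G\in\mathscr C$ with maximum degree $\Delta$ and $\operatorname{girth}(G)\ge g(r+1)$ that is not a forest satisfies $\mathrm{a}'_r(G)=\max\{\Delta,r\}$.
   Context: The generalized $r$-acyclic chromatic index $\mathrm{a}'_r(G)$ is the minimum number of colors in a proper edge coloring of $G$ such that every cycle $C$ receives at least $\min\{|C|,r\}$ colors. Forests have girth $+\infty$. A strict ear of $G$ is a path with distinct endpoints whose internal vertices have degree $2$ in $G$; a $p$-reduction deletes an isolated vertex, a vertex of degree $1$, or the internal vertices of a strict ear of length at least $p$; $G$ is $p$-path degenerate if it reduces to the empty graph by $p$-reductions. For a half-integer $r\ge0$, $H$ is a shallow minor of $G$ at depth $r$ if there are vertex-disjoint rooted trees $(T_v,r_v)\subseteq G$ of radius at most $\lceil r\rceil$ such that each edge $uv\in E(H)$ has an edge $e$ of $G$ between $T_u,T_v$ with the $r_u$–$r_v$ path in $T_u\cup T_v\cup\{e\}$ of length at most $2r+1$; $\nabla_r(G)=\max\|H\|/|H|$ over such non-empty $H$; $\mathrm{Exp}_{\mathscr C}(r)=\sup_{G\in\mathscr C}\nabla_r(G)$; sub-exponential expansion means $\mathrm{Exp}_{\mathscr C}(r)<\infty$ for all $r$ and $\mathrm{Exp}_{\mathscr C}(r)=2^{o(r)}$. (Such a function $g$ exists for every class with sub-exponential expansion.) -}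

module Defs where

open import Data.Nat using (_<?_; ℕ; zero; suc; _+_; _*_; _^_; _≤_; _<_; _⊔_; _⊓_; _∸_; _/_)
open import Data.Bool using (Bool; true; false; _∧_; not; if_then_else_)
open import Data.Fin using (Fin; toℕ)
open import Data.Fin.Properties using () renaming (_≟_ to _≟ᶠ_)
open import Data.Maybe using (Maybe; just; nothing)
open import Data.List using (List; []; _∷_; _++_; [_]; length; map; zip; allFin; foldr; deduplicate)
open import Data.Nat.ListAction using (sum)
open import Data.Bool.ListAction using (any)
open import Data.List.Relation.Unary.All using (All)
open import Data.List.Relation.Unary.Unique.Propositional using (Unique)
open import Data.Product using (Σ; _×_; _,_; ∃; ∃-syntax)
open import Relation.Binary.PropositionalEquality using (_≡_; _≢_)
open import Relation.Nullary using (¬_)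
open import Relation.Nullary.Decidable using (⌊_⌋)

record Graph : Set where
  field
    n      : ℕ
    adj    : Fin n → Fin n → Bool
    sym    : ∀ u v → adj u v ≡ adj v u
    irrefl : ∀ v → adj v v ≡ false
open Graph public

countFin : ∀ {m} → (Fin m → Bool) → ℕ
countFin {m} P = sum (map (λ w → if P w then 1 else 0) (allFin m))

VSet : Graph → Set
VSet G = Fin (n G) → Bool

degIn : (G : Graph) → VSet G → Fin (n G) → ℕ
degIn G S v = countFin (λ w → S w ∧ adj G v w)

deg : (G : Graph) → Fin (n G) → ℕ
deg G v = degIn G (λ _ → true) v

-- maximum degree Δ(G) (0 for the empty graph)
maxDeg : Graph → ℕ
maxDeg G = foldr _⊔_ 0 (map (deg G) (allFin (n G)))

consecPairs : ∀ {A : Set} → List A → List (A × A)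
consecPairs []       = []
consecPairs (x ∷ xs) = zip (x ∷ xs) xs

cyclePairs : ∀ {A : Set} → List A → List (A × A)
cyclePairs []       = []
cyclePairs (x ∷ xs) = zip (x ∷ xs) (xs ++ [ x ])

IsEdge : (G : Graph) → Fin (n G) × Fin (n G) → Set
IsEdge G (u , v) = adj G u v ≡ true

IsCycle : (G : Graph) → List (Fin (n G)) → Set
IsCycle G vs = (3 ≤ length vs) × Unique vs × All (IsEdge G) (cyclePairs vs)

-- girth(G) ≥ m  (forests have girth +∞)
GirthAtLeast : Graph → ℕ → Set
GirthAtLeast G m = ∀ vs → IsCycle G vs → m ≤ length vs

IsForest : Graph → Set
IsForest G = ∀ vs → ¬ IsCycle G vs

-- proper edge colouring with colours Fin k (values on non-edges irrelevant)
record ProperEdgeColouring (G : Graph) (k : ℕ) : Set where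
  field
    col      : Fin (n G) → Fin (n G) → Fin k
    col-sym  : ∀ u v → adj G u v ≡ true → col u v ≡ col v u
    proper   : ∀ u v w → adj G u v ≡ true → adj G u w ≡ true → v ≢ w →
               col u v ≢ col u w
open ProperEdgeColouring public

coloursOnCycle : ∀ {G k} → ProperEdgeColouring G k → List (Fin (n G)) → ℕ
coloursOnCycle {G} {k} c vs =
  length (deduplicate _≟ᶠ_ (map (λ e → col c (Data.Product.proj₁ e) (Data.Product.proj₂ e)) (cyclePairs vs)))

IsRAcyclic : ∀ {G k} → ℕ → ProperEdgeColouring G k → Set
IsRAcyclic {G} r c = ∀ vs → IsCycle G vs → (length vs ⊓ r) ≤ coloursOnCycle c vs

RAcyclicColourable : ℕ → Graph → ℕ → Set
RAcyclicColourable r G k = Σ (ProperEdgeColouring G k) (IsRAcyclic r)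

AcyclicIndexIs : ℕ → Graph → ℕ → Set
AcyclicIndexIs r G K = RAcyclicColourable r G K × (∀ k → k < K → ¬ RAcyclicColourable r G k)

-- p-reductions and p-path degeneracy (vertices removed from a set S;
-- the current graph is always the induced subgraph G[S])

removeV : ∀ {G} → VSet G → Fin (n G) → VSet G
removeV S v w = S w ∧ not ⌊ w ≟ᶠ v ⌋

removeL : ∀ {G} → VSet G → List (Fin (n G)) → VSet G
removeL S us w = S w ∧ not (any (λ u → ⌊ w ≟ᶠ u ⌋) us)

-- strict ear x, mid, y of G[S] (length = length mid + 1 edges)
IsStrictEar : (G : Graph) → VSet G → Fin (n G) → List (Fin (n G)) → Fin (n G) → Set
IsStrictEar G S x mid y =
  let ps = x ∷ (mid ++ [ y ]) in
  Unique ps × All (λ w → S w ≡ true) ps × All (IsEdge G) (consecPairs ps) ×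
  All (λ w → degIn G S w ≡ 2) mid

data PReduction (G : Graph) (p : ℕ) : VSet G → VSet G → Set where
  del-low : ∀ {S} v → S v ≡ true → degIn G S v ≤ 1 → PReduction G p S (removeV {G} S v)
  del-ear : ∀ {S} x mid y → IsStrictEar G S x mid y → p ≤ suc (length mid) →
            PReduction G p S (removeL {G} S mid)

data Reduces (G : Graph) (p : ℕ) : VSet G → Set where
  done : ∀ {S} → (∀ v → S v ≡ false) → Reduces G p S
  step : ∀ {S S'} → PReduction G p S S' → Reduces G p S' → Reduces G p S

PathDegenerate : ℕ → Graph → Set
PathDegenerate p G = Reduces G p (λ _ → true)

-- Shallow minors.  Depth is a half-integer r = d/2, encoded by d ∈ ℕ.
-- ⌈d/2⌉ = (d+1)/2 (floor division).

numEdges : ∀ {m} → (Fin m → Fin m → Bool) → ℕ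
numEdges {m} hadj =
  sum (map (λ i → countFin (λ j → hadj i j ∧ ⌊ toℕ i Data.Nat.<? toℕ j ⌋)) (allFin m))

-- H (the graph Hg, with |H| = n Hg ≥ 1) is a shallow minor of G at depth d/2:
-- branch sets are the fibres of bs (hence vertex-disjoint), each T_i is a
-- rooted tree in G given by parent pointers with depth = distance to root in T_i
record ShallowMinorModel (d : ℕ) (G : Graph) (Hg : Graph) : Set where
  field
    bs       : Fin (n G) → Maybe (Fin (n Hg))
    root     : Fin (n Hg) → Fin (n G)
    parent   : Fin (n G) → Fin (n G)
    depth    : Fin (n G) → ℕ
    root-in  : ∀ i → bs (root i) ≡ just i
    root-dep : ∀ i → depth (root i) ≡ 0
    par-in   : ∀ x i → bs x ≡ just i → x ≢ root i → bs (parent x) ≡ just i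
    par-adj  : ∀ x i → bs x ≡ just i → x ≢ root i → adj G x (parent x) ≡ true
    par-dep  : ∀ x i → bs x ≡ just i → x ≢ root i → depth x ≡ suc (depth (parent x))
    radius   : ∀ x i → bs x ≡ just i → depth x ≤ (suc d) / 2
    edges    : ∀ i j → adj Hg i j ≡ true →
               ∃[ x ] ∃[ y ] (bs x ≡ just i × bs y ≡ just j × adj G x y ≡ true ×
                              depth x + 1 + depth y ≤ d + 1)

IsShallowMinor : ℕ → Graph → Graph → Set
IsShallowMinor d G H = (1 ≤ n H) × ShallowMinorModel d G H

GraphClass : Set₁
GraphClass = Graph → Set

-- Exp_C(d/2) < ∞ : some B ∈ ℕ with ‖H‖ ≤ B·|H| for all shallow minors at depth d/2
ExpFinite : GraphClass → ℕ → Set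
ExpFinite C d = ∃[ B ] (∀ G H → C G → IsShallowMinor d G H → numEdges (adj H) ≤ B * n H)

-- Exp_C(r) = 2^{o(r)}: for every k ≥ 1, eventually Exp_C(d/2) ≤ 2^{d/k},
-- i.e. (‖H‖/|H|)^k ≤ 2^d for all shallow minors H at depth d/2 (d ≥ R)
ExpSubExp : GraphClass → Set
ExpSubExp C = ∀ k → 1 ≤ k → ∃[ R ] (∀ d → R ≤ d → ∀ G H → C G → IsShallowMinor d G H →
                 numEdges (adj H) ^ k ≤ 2 ^ d * n H ^ k)

SubExponentialExpansion : GraphClass → Set
SubExponentialExpansion C = (∀ d → ExpFinite C d) × ExpSubExp C

-- By hypothesis G is (r + 1)-path degenerate. Undoing the reductions one at a time, we keep a
-- proper edge colouring with K = max(Δ, r) ≥ 3 colours in which every cycle of the current graph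
-- sees at least r colours. A re-inserted vertex of degree at most 1 lies on no cycle, and its edge
-- takes a colour missing at its neighbour. A re-inserted strict ear x … y of length at least r + 1
-- gets colours a and b missing at x and y on its end edges, while its inner edges run through
-- r − 1 colours other than b and then alternate, so the ear is properly coloured with r distinct
-- colours; its inner vertices have degree 2, so every new cycle contains the whole ear.
-- Conversely a proper colouring needs Δ colours, and since G is not a forest it has a cycle,
-- which sees r colours in the colouring above and hence has length at least r, so needs r colours.

module Submission where

open import Defs hiding (sym)
open import Data.Bool using (Bool; true; false; _∧_; _∨_; not; if_then_else_; T; T?)
open import Data.Bool.Properties using (∧-identityʳ; ∧-zeroʳ) renaming (_≟_ to _≟ᵇ_)
open import Data.Bool.ListAction using (any)
open import Data.Empty using (⊥; ⊥-elim)
open import Data.Fin using (Fin; fromℕ<; punchIn; opposite)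
open import Data.Fin.Properties using (any?; opposite-involutive; punchIn-injective; punchInᵢ≢i; fromℕ<-injective)
  renaming (_≟_ to _≟ᶠ_)
open import Data.List using (List; []; _∷_; _++_; [_]; length; map; zip; foldr; allFin; upTo; filterᵇ; deduplicate)
open import Data.List.Properties
  using (map-cong-local; length-map; length-tabulate; length-++; length-removeAt′; length-zipWith; length-deduplicate; length-upTo)
open import Data.List.Membership.Propositional using (_∈_; _∉_; _─_; find)
open import Data.List.Membership.Propositional.Properties
  using (∈-allFin; ∈-map⁺; ∈-map⁻; ∈-filter⁺; ∈-filter⁻; ∈-++⁺ˡ; ∈-++⁺ʳ; ∈-++⁻; ∈-deduplicate⁺; ∈-upTo⁻)
import Data.List.Membership.DecPropositional as DecMembership
open import Data.List.Relation.Binary.Subset.Propositional using (_⊆_)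
open import Data.List.Relation.Unary.All as All using (All; []; _∷_)
open import Data.List.Relation.Unary.All.Properties as All using ()
open import Data.List.Relation.Unary.Any as Any using (here; there; index)
open import Data.List.Relation.Unary.AllPairs using ([]; _∷_)
open import Data.List.Relation.Unary.Unique.Propositional using (Unique)
open import Data.List.Relation.Unary.Unique.Propositional.Properties using (allFin⁺; filter⁺; upTo⁺)
open import Data.List.Relation.Unary.Unique.DecPropositional.Properties using (deduplicate-!)
open import Data.Nat.ListAction using (sum)
open import Data.Nat using (ℕ; zero; suc; pred; _≤_; _<_; _+_; _∸_; _⊔_; _⊓_; z≤n; s≤s; z<s; _<?_; _≟_)
open import Data.Nat.Properties
open import Data.Product using (_×_; _,_; proj₁; proj₂; ∃-syntax)
open import Data.Sum using (_⊎_; inj₁; inj₂; [_,_]′)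
open import Function using (_∘_)
open import Relation.Binary.PropositionalEquality using (_≡_; _≢_; refl; sym; trans; cong; cong₂; subst)
open import Relation.Nullary using (¬_; Dec; yes; no; ¬?; contradiction)
open import Relation.Nullary.Decidable using (⌊_⌋; decidable-stable; _×-dec_; _⊎-dec_)

∈-─ : ∀ {A : Set} {x z : A} {ys} (x∈ys : x ∈ ys) → z ∈ ys → z ≢ x → z ∈ ys ─ x∈ys
∈-─ (here refl) (here refl) z≢x = ⊥-elim (z≢x refl)
∈-─ (here refl) (there z∈ys) _   = z∈ys
∈-─ (there _)   (here refl)  _   = here refl
∈-─ (there x∈ys) (there z∈ys) z≢x = there (∈-─ x∈ys z∈ys z≢x)

unique-⊆⇒length≤ : ∀ {A : Set} {xs ys : List A} → Unique xs → xs ⊆ ys → length xs ≤ length ys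
unique-⊆⇒length≤ {xs = []} _ _ = z≤n
unique-⊆⇒length≤ {xs = x ∷ xs} {ys} (x∉xs ∷ !xs) xs⊆ys =
  subst (suc (length xs) ≤_) (sym (length-removeAt′ ys (index x∈ys)))
    (s≤s (unique-⊆⇒length≤ !xs λ z∈xs → ∈-─ x∈ys (xs⊆ys (there z∈xs)) (All.lookup x∉xs z∈xs ∘ sym)))
  where
  x∈ys : x ∈ ys
  x∈ys = xs⊆ys (here refl)

length-allFin : ∀ m → length (allFin m) ≡ m
length-allFin m = length-tabulate {n = m} (λ i → i)

unique-Fin⇒length≤ : ∀ {m} {xs : List (Fin m)} → Unique xs → length xs ≤ m
unique-Fin⇒length≤ {m} {xs} !xs =
  subst (length xs ≤_) (length-allFin m) (unique-⊆⇒length≤ !xs (λ {z} _ → ∈-allFin z))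

map⁺-locally-injective : ∀ {A B : Set} (f : A → B) {xs} → (∀ {a b} → a ∈ xs → b ∈ xs → a ≢ b → f a ≢ f b) →
                         Unique xs → Unique (map f xs)
map⁺-locally-injective f inj [] = []
map⁺-locally-injective f inj (x∉ ∷ !xs) =
  All.map⁺ (All.tabulate λ z∈ → inj (here refl) (there z∈) (All.lookup x∉ z∈))
  ∷ map⁺-locally-injective f (λ a∈ b∈ → inj (there a∈) (there b∈)) !xs

count≡length-filterᵇ : ∀ {A : Set} (p : A → Bool) xs →
                       sum (map (λ w → if p w then 1 else 0) xs) ≡ length (filterᵇ p xs)
count≡length-filterᵇ p [] = refl
count≡length-filterᵇ p (x ∷ xs) with p x
... | true  = cong suc (count≡length-filterᵇ p xs)
... | false = count≡length-filterᵇ p xs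

∃∉-if-length< : ∀ {m} (xs : List (Fin m)) → length xs < m → ∃[ a ] a ∉ xs
∃∉-if-length< {m} xs len< with any? (λ a → ¬? (DecMembership._∈?_ _≟ᶠ_ a xs))
... | yes fresh = fresh
... | no ¬fresh = contradiction (subst (_≤ length xs) (length-allFin m)
                                   (unique-⊆⇒length≤ (allFin⁺ m) allFin⊆xs)) (<⇒≱ len<)
  where
  allFin⊆xs : allFin m ⊆ xs
  allFin⊆xs {a} _ = decidable-stable (DecMembership._∈?_ _≟ᶠ_ a xs) (λ a∉xs → ¬fresh (a , a∉xs))

nth : ∀ {A : Set} → A → List A → ℕ → A
nth d []       _       = d
nth d (z ∷ zs) zero    = z
nth d (z ∷ zs) (suc i) = nth d zs i

nth-∈ : ∀ {A : Set} (d : A) zs {i} → i < length zs → nth d zs i ∈ zs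
nth-∈ d (z ∷ zs) {zero}  _         = here refl
nth-∈ d (z ∷ zs) {suc i} (s≤s i<) = there (nth-∈ d zs i<)

∈⇒nth : ∀ {A : Set} (d : A) {z} zs → z ∈ zs → ∃[ i ] (i < length zs × nth d zs i ≡ z)
∈⇒nth d (z ∷ zs) (here refl) = zero , s≤s z≤n , refl
∈⇒nth d (z ∷ zs) (there z∈zs) with i , i< , eq ← ∈⇒nth d zs z∈zs = suc i , s≤s i< , eq

nth-injective : ∀ {A : Set} (d : A) zs → Unique zs → ∀ {i j} → i < length zs → j < length zs →
                nth d zs i ≡ nth d zs j → i ≡ j
nth-injective d (z ∷ zs) _ {zero} {zero} _ _ _ = refl
nth-injective d (z ∷ zs) (z∉zs ∷ _) {zero} {suc j} _ (s≤s j<) eq =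
  contradiction eq (All.lookup z∉zs (nth-∈ d zs j<))
nth-injective d (z ∷ zs) (z∉zs ∷ _) {suc i} {zero} (s≤s i<) _ eq =
  contradiction (sym eq) (All.lookup z∉zs (nth-∈ d zs i<))
nth-injective d (z ∷ zs) (_ ∷ !zs) {suc i} {suc j} (s≤s i<) (s≤s j<) eq =
  cong suc (nth-injective d zs !zs i< j< eq)

nth-consecPairs : ∀ {A : Set} {R : A × A → Set} (d : A) zs → All R (consecPairs zs) →
                  ∀ {i} → suc i < length zs → R (nth d zs i , nth d zs (suc i))
nth-consecPairs d (z ∷ [])      _        {zero}  (s≤s ())
nth-consecPairs d (z ∷ z′ ∷ zs) (r ∷ _)  {zero}  _         = r
nth-consecPairs d (z ∷ z′ ∷ zs) (_ ∷ rs) {suc i} (s≤s i<) = nth-consecPairs d (z′ ∷ zs) rs i<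

nth-++ˡ : ∀ {A : Set} (d : A) xs ys {i} → i < length xs → nth d (xs ++ ys) i ≡ nth d xs i
nth-++ˡ d (x ∷ xs) ys {zero}  _         = refl
nth-++ˡ d (x ∷ xs) ys {suc i} (s≤s i<) = nth-++ˡ d xs ys i<

nth-++-length : ∀ {A : Set} (d : A) xs y → nth d (xs ++ [ y ]) (length xs) ≡ y
nth-++-length d []       y = refl
nth-++-length d (x ∷ xs) y = nth-++-length d xs y

zip-∈⁻ : ∀ {A B : Set} {a : A} {b : B} xs ys → (a , b) ∈ zip xs ys → a ∈ xs × b ∈ ys
zip-∈⁻ (x ∷ xs) (y ∷ ys) (here refl) = here refl , here refl
zip-∈⁻ (x ∷ xs) (y ∷ ys) (there ab∈) with a∈ , b∈ ← zip-∈⁻ xs ys ab∈ = there a∈ , there b∈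

zip-∈-fst : ∀ {A B : Set} {a : A} (xs : List A) (ys : List B) → length xs ≡ length ys → a ∈ xs →
            ∃[ b ] (a , b) ∈ zip xs ys
zip-∈-fst (x ∷ xs) (y ∷ ys) _ (here refl) = y , here refl
zip-∈-fst (x ∷ xs) (y ∷ ys) eq (there a∈) with b , ab∈ ← zip-∈-fst xs ys (suc-injective eq) a∈ =
  b , there ab∈

zip-∈-snd : ∀ {A B : Set} {b : B} (xs : List A) (ys : List B) → length xs ≡ length ys → b ∈ ys →
            ∃[ a ] (a , b) ∈ zip xs ys
zip-∈-snd (x ∷ xs) (y ∷ ys) _ (here refl) = x , here refl
zip-∈-snd (x ∷ xs) (y ∷ ys) eq (there b∈) with a , ab∈ ← zip-∈-snd xs ys (suc-injective eq) b∈ =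
  a , there ab∈

lastOr : ∀ {A : Set} → A → List A → A
lastOr y []       = y
lastOr _ (z ∷ zs) = lastOr z zs

lastOr-∈ : ∀ {A : Set} (y z : A) zs → lastOr y (z ∷ zs) ∈ z ∷ zs
lastOr-∈ y z []        = here refl
lastOr-∈ y z (z′ ∷ zs) = there (lastOr-∈ z z′ zs)

zip-snoc : ∀ {A : Set} (y : A) zs e → zip (y ∷ zs) (zs ++ [ e ]) ≡ consecPairs (y ∷ zs) ++ [ (lastOr y zs , e) ]
zip-snoc y []       e = refl
zip-snoc y (z ∷ zs) e = cong ((y , z) ∷_) (zip-snoc z zs e)

consecPairs-asym : ∀ {A : Set} {a b : A} zs → Unique zs →
                   (a , b) ∈ consecPairs zs → (b , a) ∉ consecPairs zs
consecPairs-asym (x ∷ z ∷ zs) (x∉ ∷ _) (here refl) (here eq) = All.lookup x∉ (here refl) (sym (cong proj₁ eq))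
consecPairs-asym (x ∷ z ∷ zs) (x∉ ∷ _) (here refl) (there ba∈) =
  All.lookup x∉ (there (proj₂ (zip-∈⁻ (z ∷ zs) zs ba∈))) refl
consecPairs-asym (x ∷ z ∷ zs) (x∉ ∷ _) (there ab∈) (here refl) =
  All.lookup x∉ (there (proj₂ (zip-∈⁻ (z ∷ zs) zs ab∈))) refl
consecPairs-asym (x ∷ z ∷ zs) (_ ∷ !zs) (there ab∈) (there ba∈) = consecPairs-asym (z ∷ zs) !zs ab∈ ba∈

closingPair-∉ : ∀ {A : Set} (v : A) zs → Unique (v ∷ zs) → 3 ≤ length (v ∷ zs) →
                (v , lastOr v zs) ∉ consecPairs (v ∷ zs)
closingPair-∉ v (z ∷ [])      _ (s≤s (s≤s ()))
closingPair-∉ v (z ∷ z′ ∷ zs) (_ ∷ z∉ ∷ _) _ (here eq) =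
  All.lookup z∉ (subst (_∈ z′ ∷ zs) (cong proj₂ eq) (lastOr-∈ z z′ zs)) refl
closingPair-∉ v (z ∷ z′ ∷ zs) (v∉ ∷ _) _ (there vw∈) =
  All.lookup v∉ (proj₁ (zip-∈⁻ (z ∷ z′ ∷ zs) (z′ ∷ zs) vw∈)) refl

lastOr≢ : ∀ {A : Set} (v : A) zs → Unique (v ∷ zs) → 3 ≤ length (v ∷ zs) → lastOr v zs ≢ v
lastOr≢ v []       _        (s≤s ())
lastOr≢ v (z ∷ zs) (v∉ ∷ _) _ eq = All.lookup v∉ (subst (_∈ z ∷ zs) eq (lastOr-∈ v z zs)) refl

cyclePairs-asym : ∀ {A : Set} {a b : A} vs → Unique vs → 3 ≤ length vs →
                  (a , b) ∈ cyclePairs vs → (b , a) ∉ cyclePairs vs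
cyclePairs-asym {a = a} {b} (v ∷ zs) !vs 3≤ ab∈ ba∈ = asym (split ab∈) (split ba∈)
  where
  split : ∀ {p} → p ∈ cyclePairs (v ∷ zs) → p ∈ consecPairs (v ∷ zs) ⊎ p ∈ [ (lastOr v zs , v) ]
  split p∈ = ∈-++⁻ (consecPairs (v ∷ zs)) (subst (_ ∈_) (zip-snoc v zs v) p∈)
  asym : (a , b) ∈ consecPairs (v ∷ zs) ⊎ (a , b) ∈ [ (lastOr v zs , v) ] →
         (b , a) ∈ consecPairs (v ∷ zs) ⊎ (b , a) ∈ [ (lastOr v zs , v) ] → ⊥
  asym (inj₁ ab∈) (inj₁ ba∈)              = consecPairs-asym (v ∷ zs) !vs ab∈ ba∈
  asym (inj₁ ab∈) (inj₂ (here refl))      = closingPair-∉ v zs !vs 3≤ ab∈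
  asym (inj₂ (here refl)) (inj₁ ba∈)      = closingPair-∉ v zs !vs 3≤ ba∈
  asym (inj₂ (here refl)) (inj₂ (here eq)) = lastOr≢ v zs !vs 3≤ (sym (cong proj₁ eq))

module _ {A : Set} (v : A) (zs : List A) where

  rotate-⊆ : zs ++ [ v ] ⊆ v ∷ zs
  rotate-⊆ z∈ with ∈-++⁻ zs z∈
  ... | inj₁ z∈zs        = there z∈zs
  ... | inj₂ (here refl) = here refl

  rotate-⊇ : v ∷ zs ⊆ zs ++ [ v ]
  rotate-⊇ (here refl) = ∈-++⁺ʳ zs (here refl)
  rotate-⊇ (there z∈)  = ∈-++⁺ˡ z∈

  length-rotate : length (v ∷ zs) ≡ length (zs ++ [ v ])
  length-rotate = trans (+-comm 1 (length zs)) (sym (length-++ zs))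

cyclePairs-∈⁻ : ∀ {A : Set} {a b : A} vs → (a , b) ∈ cyclePairs vs → a ∈ vs × b ∈ vs
cyclePairs-∈⁻ (v ∷ zs) ab∈ with a∈ , b∈ ← zip-∈⁻ (v ∷ zs) (zs ++ [ v ]) ab∈ = a∈ , rotate-⊆ v zs b∈

length-cyclePairs : ∀ {A : Set} (vs : List A) → length (cyclePairs vs) ≡ length vs
length-cyclePairs []       = refl
length-cyclePairs (v ∷ zs) = trans (length-zipWith _,_ (v ∷ zs) (zs ++ [ v ]))
  (trans (cong (length (v ∷ zs) ⊓_) (sym (length-rotate v zs))) (⊓-idem (length (v ∷ zs))))

cycleSuccessor : ∀ {A : Set} {a : A} vs → a ∈ vs → ∃[ b ] (a , b) ∈ cyclePairs vs
cycleSuccessor (v ∷ zs) = zip-∈-fst (v ∷ zs) (zs ++ [ v ]) (length-rotate v zs)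

cyclePredecessor : ∀ {A : Set} {b : A} vs → b ∈ vs → ∃[ a ] (a , b) ∈ cyclePairs vs
cyclePredecessor (v ∷ zs) b∈ = zip-∈-snd (v ∷ zs) (zs ++ [ v ]) (length-rotate v zs) (rotate-⊇ v zs b∈)

cycleNeighbours : ∀ {A : Set} {u : A} vs → Unique vs → 3 ≤ length vs → u ∈ vs →
                  ∃[ s ] ∃[ p ] ((u , s) ∈ cyclePairs vs × (p , u) ∈ cyclePairs vs × s ≢ p)
cycleNeighbours vs !vs 3≤ u∈ with s , us∈ ← cycleSuccessor vs u∈ | p , pu∈ ← cyclePredecessor vs u∈ =
  s , p , us∈ , pu∈ , λ { refl → cyclePairs-asym vs !vs 3≤ us∈ pu∈ }

adj-sym : (G : Graph) {u v : Fin (n G)} → adj G u v ≡ true → adj G v u ≡ true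
adj-sym G {u} {v} = trans (Graph.sym G v u)

neighbours : (G : Graph) → VSet G → Fin (n G) → List (Fin (n G))
neighbours G S v = filterᵇ (λ w → S w ∧ adj G v w) (allFin (n G))

module _ (G : Graph) (S : VSet G) (v : Fin (n G)) where

  degIn≡length-neighbours : degIn G S v ≡ length (neighbours G S v)
  degIn≡length-neighbours = count≡length-filterᵇ (λ w → S w ∧ adj G v w) (allFin (n G))

  ∈-neighbours⁺ : ∀ {w} → S w ≡ true → adj G v w ≡ true → w ∈ neighbours G S v
  ∈-neighbours⁺ {w} Sw vw = ∈-filter⁺ (T? ∘ λ w → S w ∧ adj G v w) (∈-allFin w) (T-∧ Sw vw)
    where
    T-∧ : ∀ {a b} → a ≡ true → b ≡ true → T (a ∧ b)
    T-∧ refl refl = _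

  ∈-neighbours⁻ : ∀ {w} → w ∈ neighbours G S v → S w ≡ true × adj G v w ≡ true
  ∈-neighbours⁻ {w} w∈ = T-∧⁻ (proj₂ (∈-filter⁻ (T? ∘ λ w → S w ∧ adj G v w) {xs = allFin (n G)} w∈))
    where
    T-∧⁻ : ∀ {a b} → T (a ∧ b) → a ≡ true × b ≡ true
    T-∧⁻ {true} {true} _ = refl , refl

  neighbours-unique : Unique (neighbours G S v)
  neighbours-unique = filter⁺ _ (allFin⁺ (n G))

  unique⊆neighbours⇒≤degIn : ∀ {ws} → Unique ws → ws ⊆ neighbours G S v → length ws ≤ degIn G S v
  unique⊆neighbours⇒≤degIn !ws ws⊆ = subst (_ ≤_) (sym degIn≡length-neighbours) (unique-⊆⇒length≤ !ws ws⊆)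

∈-saturated-neighbours : (G : Graph) (S : VSet G) (v : Fin (n G)) {ws : List (Fin (n G))} →
                         Unique ws → ws ⊆ neighbours G S v → degIn G S v ≤ length ws →
                         ∀ {w} → S w ≡ true → adj G v w ≡ true → w ∈ ws
∈-saturated-neighbours G S v {ws} !ws ws⊆ deg≤ {w} Sw vw =
  decidable-stable (DecMembership._∈?_ _≟ᶠ_ w ws) λ w∉ws →
    1+n≰n (≤-trans (unique⊆neighbours⇒≤degIn G S v (All.tabulate (λ { w∈ refl → w∉ws w∈ }) ∷ !ws) w∷ws⊆) deg≤)
  where
  w∷ws⊆ : w ∷ ws ⊆ neighbours G S v
  w∷ws⊆ (here refl) = ∈-neighbours⁺ G S v Sw vw
  w∷ws⊆ (there w∈)  = ws⊆ w∈

degIn≤deg : (G : Graph) (S : VSet G) (v : Fin (n G)) → degIn G S v ≤ deg G v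
degIn≤deg G S v = subst (_≤ deg G v) (sym (degIn≡length-neighbours G S v))
  (unique⊆neighbours⇒≤degIn G (λ _ → true) v (neighbours-unique G S v)
    λ w∈ → ∈-neighbours⁺ G (λ _ → true) v refl (proj₂ (∈-neighbours⁻ G S v w∈)))

degIn-removal : (G : Graph) {S S′ : VSet G} {u v : Fin (n G)} → (∀ w → S′ w ≡ true → S w ≡ true) →
                S u ≡ true → S′ u ≡ false → adj G v u ≡ true → degIn G S′ v < degIn G S v
degIn-removal G {S} {S′} {u} {v} S′⊆S Su S′u vu =
  subst (_< degIn G S v) (sym (degIn≡length-neighbours G S′ v))
    (unique⊆neighbours⇒≤degIn G S v (u∉ ∷ neighbours-unique G S′ v) ⊆S)
  where
  u∉ : All (u ≢_) (neighbours G S′ v)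
  u∉ = All.tabulate λ { w∈ refl → contradiction (trans (sym (proj₁ (∈-neighbours⁻ G S′ v w∈))) S′u) λ () }
  ⊆S : u ∷ neighbours G S′ v ⊆ neighbours G S v
  ⊆S (here refl) = ∈-neighbours⁺ G S v Su vu
  ⊆S (there w∈)  = let S′w , vw = ∈-neighbours⁻ G S′ v w∈ in ∈-neighbours⁺ G S v (S′⊆S _ S′w) vw

foldr-⊔-upper : ∀ {A : Set} (f : A → ℕ) xs {x} → x ∈ xs → f x ≤ foldr _⊔_ 0 (map f xs)
foldr-⊔-upper f (y ∷ ys) (here refl) = m≤m⊔n _ _
foldr-⊔-upper f (y ∷ ys) (there x∈)  = ≤-trans (foldr-⊔-upper f ys x∈) (m≤n⊔m (f y) _)

foldr-⊔-attained : ∀ {A : Set} (f : A → ℕ) xs {k} → k < foldr _⊔_ 0 (map f xs) → ∃[ x ] k < f x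
foldr-⊔-attained f (y ∷ ys) k< with ⊔-sel (f y) (foldr _⊔_ 0 (map f ys))
... | inj₁ eq = y , subst (_ <_) eq k<
... | inj₂ eq = foldr-⊔-attained f ys (subst (_ <_) eq k<)

deg≤maxDeg : (G : Graph) (v : Fin (n G)) → deg G v ≤ maxDeg G
deg≤maxDeg G v = foldr-⊔-upper (deg G) (allFin (n G)) (∈-allFin v)

maxDeg-attained : (G : Graph) {k : ℕ} → k < maxDeg G → ∃[ v ] k < deg G v
maxDeg-attained G = foldr-⊔-attained (deg G) (allFin (n G))

deg≤colours : (G : Graph) {k : ℕ} (c : ProperEdgeColouring G k) (v : Fin (n G)) → deg G v ≤ k
deg≤colours G {k} c v = begin
  deg G v                   ≡⟨ degIn≡length-neighbours G all v ⟩
  length ns                 ≡⟨ length-map (col c v) ns ⟨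
  length (map (col c v) ns) ≤⟨ unique-Fin⇒length≤ (map⁺-locally-injective (col c v) distinct
                                                         (neighbours-unique G all v)) ⟩
  k                         ∎
  where
  open ≤-Reasoning
  all : VSet G
  all _ = true
  ns : List (Fin (n G))
  ns = neighbours G all v
  distinct : ∀ {a b} → a ∈ ns → b ∈ ns → a ≢ b → col c v a ≢ col c v b
  distinct a∈ b∈ = proper c v _ _ (proj₂ (∈-neighbours⁻ G all v a∈)) (proj₂ (∈-neighbours⁻ G all v b∈))

missingColour : (G : Graph) (S : VSet G) {K : ℕ} (f : Fin (n G) → Fin (n G) → Fin K) (v : Fin (n G)) →
                degIn G S v < K → ∃[ a ] (∀ w → S w ≡ true → adj G v w ≡ true → f v w ≢ a)
missingColour G S {K} f v deg<K =
  let a , a∉ = ∃∉-if-length< (map (f v) ns) len<K in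
  a , λ w Sw vw eq → a∉ (subst (_∈ map (f v) ns) eq (∈-map⁺ (f v) (∈-neighbours⁺ G S v Sw vw)))
  where
  ns : List (Fin (n G))
  ns = neighbours G S v
  len<K : length (map (f v) ns) < K
  len<K = subst (_< K) (trans (degIn≡length-neighbours G S v) (sym (length-map (f v) ns))) deg<K

edgeColours : ∀ {A : Set} {K} → (A → A → Fin K) → List A → List (Fin K)
edgeColours f vs = map (λ e → f (proj₁ e) (proj₂ e)) (cyclePairs vs)

coloursOn : ∀ {A : Set} {K} → (A → A → Fin K) → List A → ℕ
coloursOn f vs = length (deduplicate _≟ᶠ_ (edgeColours f vs))

module _ {A : Set} {K : ℕ} (f : A → A → Fin K) (vs : List A) where

  coloursOn≤length : coloursOn f vs ≤ length vs
  coloursOn≤length = begin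
    coloursOn f vs               ≤⟨ length-deduplicate _≟ᶠ_ (edgeColours f vs) ⟩
    length (edgeColours f vs)    ≡⟨ length-map _ (cyclePairs vs) ⟩
    length (cyclePairs vs)       ≡⟨ length-cyclePairs vs ⟩
    length vs                    ∎
    where open ≤-Reasoning

  coloursOn≤colours : coloursOn f vs ≤ K
  coloursOn≤colours = unique-Fin⇒length≤ (deduplicate-! _≟ᶠ_ (edgeColours f vs))

  unique⊆edgeColours⇒≤coloursOn : ∀ {cs} → Unique cs → cs ⊆ edgeColours f vs → length cs ≤ coloursOn f vs
  unique⊆edgeColours⇒≤coloursOn !cs cs⊆ = unique-⊆⇒length≤ !cs (∈-deduplicate⁺ _≟ᶠ_ ∘ cs⊆)

coloursOn-cong : ∀ {A : Set} {K} {f g : A → A → Fin K} vs →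
                 (∀ {a b} → a ∈ vs → b ∈ vs → f a b ≡ g a b) → coloursOn f vs ≡ coloursOn g vs
coloursOn-cong vs f≗g = cong (length ∘ deduplicate _≟ᶠ_) (map-cong-local (All.tabulate λ {e} e∈ →
  let a∈ , b∈ = cyclePairs-∈⁻ vs e∈ in f≗g a∈ b∈))

-- Colouring the edges of an ear

bounce : ℕ → ℕ → ℕ
bounce m x with x <? m
... | yes _ = suc x
... | no  _ = pred x

-- walk m visits 0, 1, …, m and then alternates between m ∸ 1 and m.
walk : ℕ → ℕ → ℕ
walk m zero    = zero
walk m (suc j) = bounce m (walk m j)

walk-≤ : ∀ m j → walk m j ≤ m
walk-≤ m zero    = z≤n
walk-≤ m (suc j) with walk m j <? m
... | yes x<m = x<m
... | no  _   = ≤-trans pred[n]≤n (walk-≤ m j)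

walk-identity : ∀ m {j} → j ≤ m → walk m j ≡ j
walk-identity m {zero}  _    = refl
walk-identity m {suc j} j<m with walk m j | walk-identity m (<⇒≤ j<m)
... | .j | refl with j <? m
...   | yes _   = refl
...   | no  j≮m = contradiction j<m j≮m

walk-step-≢ : ∀ {m} → 1 ≤ m → ∀ j → walk m (suc j) ≢ walk m j
walk-step-≢ {m} 1≤m j with walk m j | walk-≤ m j
... | x | x≤m with x <? m
...   | yes _   = 1+n≢n
...   | no  x≮m = pred≢ x (≤-trans 1≤m (≮⇒≥ x≮m))
  where
  pred≢ : ∀ x → 1 ≤ x → pred x ≢ x
  pred≢ (suc x) _ = 1+n≢n ∘ sym

opposite-injective : ∀ {m} {i j : Fin m} → opposite i ≡ opposite j → i ≡ j
opposite-injective {i = i} {j} eq =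
  trans (sym (opposite-involutive i)) (trans (cong opposite eq) (opposite-involutive j))

orient : ∀ {m} → Bool → Fin m → Fin m
orient false i = i
orient true  i = opposite i

orient-injective : ∀ {m} o {i j : Fin m} → orient o i ≡ orient o j → i ≡ j
orient-injective false eq = eq
orient-injective true  eq = opposite-injective eq

-- The colours other than b, enumerated in one of two orders.
paletteColour : ∀ {m} → Bool → Fin (suc m) → (t : ℕ) → .(t < m) → Fin (suc m)
paletteColour o b t t<m = punchIn b (orient o (fromℕ< t<m))

paletteColour-injective : ∀ {m} o (b : Fin (suc m)) {t t′} .(t< : t < m) .(t′< : t′ < m) →
                          paletteColour o b t t< ≡ paletteColour o b t′ t′< → t ≡ t′
paletteColour-injective o b {t} {t′} t< t′< eq =
  fromℕ<-injective t t′ t< t′< (orient-injective o (punchIn-injective b _ _ eq))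

paletteColour≢ : ∀ {m} o (b : Fin (suc m)) t .(t< : t < m) → paletteColour o b t t< ≢ b
paletteColour≢ o b t t< = punchInᵢ≢i b _

paletteColour-avoids : ∀ {k} (a b : Fin (3 + k)) → ∃[ o ] paletteColour o b 0 z<s ≢ a
paletteColour-avoids a b with paletteColour false b 0 z<s ≟ᶠ a
... | no  first≢a = false , first≢a
... | yes first≡a = true , λ last≡a → contradiction (punchIn-injective b _ _ (trans last≡a (sym first≡a))) λ ()

record EarColouring (K r l : ℕ) (a b : Fin K) : Set where
  field
    colour         : ℕ → Fin K
    colour-first   : colour 0 ≡ a
    colour-last    : colour l ≡ b
    colour-step    : ∀ {i} → i < l → colour i ≢ colour (suc i)
    palette        : List (Fin K)
    palette-unique : Unique palette
    palette-length : length palette ≡ r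
    palette-used   : All (λ c → ∃[ i ] (i ≤ l × colour i ≡ c)) palette

-- The inner edges run through the colours other than b along walk (r ∸ 2), which
-- shows r ∸ 1 of them before alternating; the last edge gets b.
earColouring : ∀ {k r l} → 3 ≤ r → r ≤ 3 + k → r ≤ l → (a b : Fin (3 + k)) → EarColouring (3 + k) r l a b
earColouring {k} {r} {l} 3≤r r≤K r≤l a b = record
  { colour         = colour
  ; colour-first   = refl
  ; colour-last    = colour-last
  ; colour-step    = colour-step
  ; palette        = b ∷ map inner (upTo (suc m))
  ; palette-unique = All.tabulate (λ c∈ → inner≢b-at c∈ ∘ sym)
                     ∷ map⁺-locally-injective inner inner-distinct (upTo⁺ (suc m))
  ; palette-length = trans (cong suc (trans (length-map inner (upTo (suc m))) (length-upTo (suc m)))) 2+m≡r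
  ; palette-used   = (l , ≤-refl , colour-last) ∷ All.map⁺ (All.tabulate used)
  }
  where
  m : ℕ
  m = r ∸ 2

  1≤m : 1 ≤ m
  1≤m = ∸-monoˡ-≤ 2 3≤r

  2+m≡r : 2 + m ≡ r
  2+m≡r = m+[n∸m]≡n (≤-trans (n≤1+n 2) 3≤r)

  m<2+k : m < 2 + k
  m<2+k = s≤s (∸-monoˡ-≤ 2 r≤K)

  o : Bool
  o = proj₁ (paletteColour-avoids a b)

  walk<2+k : ∀ j → walk m j < 2 + k
  walk<2+k j = ≤-<-trans (walk-≤ m j) m<2+k

  inner : ℕ → Fin (3 + k)
  inner j = paletteColour o b (walk m j) (walk<2+k j)

  inner≢b-at : ∀ {c} → c ∈ map inner (upTo (suc m)) → c ≢ b
  inner≢b-at c∈ with j , _ , c≡ ← ∈-map⁻ inner {xs = upTo (suc m)} c∈ =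
    subst (_≢ b) (sym c≡) (paletteColour≢ o b (walk m j) (walk<2+k j))

  inner-injective : ∀ i j → inner i ≡ inner j → walk m i ≡ walk m j
  inner-injective i j = paletteColour-injective o b (walk<2+k i) (walk<2+k j)

  inner-distinct : ∀ {i j} → i ∈ upTo (suc m) → j ∈ upTo (suc m) → i ≢ j → inner i ≢ inner j
  inner-distinct {i} {j} i∈ j∈ i≢j eq = i≢j (trans (sym (walk-identity m (≤-pred (∈-upTo⁻ i∈))))
                                  (trans (inner-injective i j eq) (walk-identity m (≤-pred (∈-upTo⁻ j∈)))))

  colour : ℕ → Fin (3 + k)
  colour zero    = a
  colour (suc j) = if ⌊ suc j ≟ l ⌋ then b else inner j

  colour-inner : ∀ j → suc j ≢ l → colour (suc j) ≡ inner j
  colour-inner j sj≢l with suc j ≟ l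
  ... | yes sj≡l = contradiction sj≡l sj≢l
  ... | no  _    = refl

  colour-end : ∀ j → suc j ≡ l → colour (suc j) ≡ b
  colour-end j sj≡l with suc j ≟ l
  ... | yes _    = refl
  ... | no  sj≢l = contradiction sj≡l sj≢l

  colour-last : colour l ≡ b
  colour-last = subst (λ i → colour i ≡ b) l≡ (colour-end (l ∸ 1) l≡)
    where
    l≡ : suc (l ∸ 1) ≡ l
    l≡ = m+[n∸m]≡n (≤-trans (≤-trans (s≤s z≤n) 3≤r) r≤l)

  colour-step : ∀ {i} → i < l → colour i ≢ colour (suc i)
  colour-step {zero} _ eq = proj₂ (paletteColour-avoids a b) (sym (trans eq (colour-inner 0 1≢l)))
    where
    1≢l : 1 ≢ l
    1≢l refl = contradiction 3≤r (<⇒≱ (≤-<-trans r≤l (s≤s (s≤s z≤n))))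
  colour-step {suc j} sj<l = distinct (suc (suc j) ≟ l)
    where
    colour≡inner : colour (suc j) ≡ inner j
    colour≡inner = colour-inner j (<⇒≢ sj<l)
    distinct : Dec (suc (suc j) ≡ l) → colour (suc j) ≢ colour (suc (suc j))
    distinct (yes ssj≡l) eq = paletteColour≢ o b (walk m j) (walk<2+k j)
                                (trans (sym colour≡inner) (trans eq (colour-end (suc j) ssj≡l)))
    distinct (no  ssj≢l) eq = walk-step-≢ 1≤m j (sym (inner-injective j (suc j)
                            (trans (sym colour≡inner) (trans eq (colour-inner (suc j) ssj≢l)))))

  used : ∀ {j} → j ∈ upTo (suc m) → ∃[ i ] (i ≤ l × colour i ≡ inner j)
  used {j} j∈ = suc j , <⇒≤ sj<l , colour-inner j (<⇒≢ sj<l)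
    where
    sj<l : suc j < l
    sj<l = ≤-trans (s≤s (∈-upTo⁻ j∈)) (≤-trans (≤-reflexive 2+m≡r) r≤l)

∧-true⁻ : ∀ {a b} → a ∧ b ≡ true → a ≡ true × b ≡ true
∧-true⁻ {true} {true} _ = refl , refl

module _ {G : Graph} (S : VSet G) where

  removeV-⊆ : ∀ v w → removeV {G} S v w ≡ true → S w ≡ true
  removeV-⊆ v w = proj₁ ∘ ∧-true⁻

  removeV-keeps : ∀ v w → S w ≡ true → w ≢ v → removeV {G} S v w ≡ true
  removeV-keeps v w Sw w≢v with w ≟ᶠ v
  ... | yes w≡v = contradiction w≡v w≢v
  ... | no  _   = trans (∧-identityʳ (S w)) Sw

  removeV-removes : ∀ v → removeV {G} S v v ≡ false
  removeV-removes v with v ≟ᶠ v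
  ... | yes _   = ∧-zeroʳ (S v)
  ... | no  v≢v = contradiction refl v≢v

  removeL-⊆ : ∀ us w → removeL {G} S us w ≡ true → S w ≡ true
  removeL-⊆ us w = proj₁ ∘ ∧-true⁻

  private
    any≡-∈ : ∀ {w : Fin (n G)} us → w ∈ us → any (λ u → ⌊ w ≟ᶠ u ⌋) us ≡ true
    any≡-∈ {w} (u ∷ us) (here refl) with w ≟ᶠ w
    ... | yes _   = refl
    ... | no  w≢w = contradiction refl w≢w
    any≡-∈ {w} (u ∷ us) (there w∈) with ⌊ w ≟ᶠ u ⌋
    ... | true  = refl
    ... | false = any≡-∈ us w∈

    any≡-∉ : ∀ {w : Fin (n G)} us → w ∉ us → any (λ u → ⌊ w ≟ᶠ u ⌋) us ≡ false
    any≡-∉     []       _   = refl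
    any≡-∉ {w} (u ∷ us) w∉ with w ≟ᶠ u
    ... | yes w≡u = contradiction (here w≡u) w∉
    ... | no  _   = any≡-∉ us (w∉ ∘ there)

  removeL-keeps : ∀ us w → S w ≡ true → w ∉ us → removeL {G} S us w ≡ true
  removeL-keeps us w Sw w∉ = cong₂ (λ a b → a ∧ not b) Sw (any≡-∉ us w∉)

  removeL-removes : ∀ us w → w ∈ us → removeL {G} S us w ≡ false
  removeL-removes us w w∈ = trans (cong (λ b → S w ∧ not b) (any≡-∈ us w∈)) (∧-zeroʳ (S w))

-- Colouring along a reduction sequence

-- The ear construction needs at least three colours, hence 3 + k of them.
module ReductionColouring (G : Graph) {r k : ℕ} (3≤r : 3 ≤ r) (Δ≤K : maxDeg G ≤ 3 + k) (r≤K : r ≤ 3 + k) where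

  V : Set
  V = Fin (n G)

  K : ℕ
  K = 3 + k

  record Colouring (S : VSet G) : Set where
    field
      colour           : V → V → Fin K
      colour-sym       : ∀ u v → S u ≡ true → S v ≡ true → adj G u v ≡ true → colour u v ≡ colour v u
      colour-proper    : ∀ u v w → S u ≡ true → S v ≡ true → S w ≡ true → adj G u v ≡ true → adj G u w ≡ true →
                         v ≢ w → colour u v ≢ colour u w
      colourful-cycles : ∀ vs → IsCycle G vs → All (λ w → S w ≡ true) vs → r ≤ coloursOn colour vs
  open Colouring public

  degIn≤K : ∀ S u → degIn G S u ≤ K
  degIn≤K S u = ≤-trans (degIn≤deg G S u) (≤-trans (deg≤maxDeg G u) Δ≤K)

  cycleNeighboursIn : ∀ {S : VSet G} vs → IsCycle G vs → All (λ w → S w ≡ true) vs → ∀ {u} → u ∈ vs →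
                      ∃[ s ] ∃[ p ] (S s ≡ true × S p ≡ true × adj G u s ≡ true × adj G u p ≡ true × s ≢ p ×
                                     (u , s) ∈ cyclePairs vs × (p , u) ∈ cyclePairs vs)
  cycleNeighboursIn vs (3≤ , !vs , edges) inS u∈ with s , p , us∈ , pu∈ , s≢p ← cycleNeighbours vs !vs 3≤ u∈ =
    s , p , All.lookup inS (proj₂ (cyclePairs-∈⁻ vs us∈)) , All.lookup inS (proj₁ (cyclePairs-∈⁻ vs pu∈)) ,
    All.lookup edges us∈ , adj-sym G (All.lookup edges pu∈) , s≢p , us∈ , pu∈

  colouring-empty : ∀ {S} → (∀ v → S v ≡ false) → Colouring S
  colouring-empty {S} S≡∅ = record
    { colour           = λ _ _ → Fin.zero
    ; colour-sym       = λ u _ Su → ⊥-elim (∉S Su)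
    ; colour-proper    = λ u _ _ Su → ⊥-elim (∉S Su)
    ; colourful-cycles = λ { (v ∷ _) _ (Sv ∷ _) → ⊥-elim (∉S Sv) }
    }
    where
    ∉S : ∀ {u} → S u ≡ true → ⊥
    ∉S {u} Su = contradiction (trans (sym Su) (S≡∅ u)) λ ()

  module _ {S : VSet G} (v : V) (Sv : S v ≡ true) (deg≤1 : degIn G S v ≤ 1) (c : Colouring (removeV {G} S v)) where

    private
      S′ : VSet G
      S′ = removeV {G} S v

      S′-keeps : ∀ w → S w ≡ true → w ≢ v → S′ w ≡ true
      S′-keeps = removeV-keeps {G} S v

      leaf-neighbour-unique : ∀ {y z} → S y ≡ true → S z ≡ true → adj G v y ≡ true → adj G v z ≡ true → z ≡ y
      leaf-neighbour-unique {y} Sy Sz vy vz with here z≡y ← ∈-saturated-neighbours G S v ([] ∷ [])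
          (λ { (here refl) → ∈-neighbours⁺ G S v Sy vy }) deg≤1 Sz vz = z≡y

      leafColour : ∃[ α ] (∀ u w → S u ≡ true → adj G v u ≡ true → S′ w ≡ true → adj G u w ≡ true → colour c u w ≢ α)
      leafColour with any? (λ u → (S u ≟ᵇ true) ×-dec (adj G v u ≟ᵇ true))
      ... | no  none = Fin.zero , λ u _ Su vu → contradiction (u , Su , vu) none
      ... | yes (u₀ , Su₀ , vu₀) = proj₁ missingAtu₀ , missingAt
        where
        deg′<K : degIn G S′ u₀ < K
        deg′<K = ≤-trans (degIn-removal G (removeV-⊆ {G} S v) Sv (removeV-removes {G} S v) (adj-sym G vu₀))
                         (degIn≤K S u₀)
        missingAtu₀ : ∃[ α ] (∀ w → S′ w ≡ true → adj G u₀ w ≡ true → colour c u₀ w ≢ α)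
        missingAtu₀ = missingColour G S′ (colour c) u₀ deg′<K
        missingAt : ∀ u w → S u ≡ true → adj G v u ≡ true → S′ w ≡ true → adj G u w ≡ true →
                    colour c u w ≢ proj₁ missingAtu₀
        missingAt u w Su vu S′w uw with refl ← leaf-neighbour-unique Su₀ Su vu₀ vu = proj₂ missingAtu₀ w S′w uw

      α : Fin K
      α = proj₁ leafColour

      α-missing : ∀ u w → S u ≡ true → adj G v u ≡ true → S′ w ≡ true → adj G u w ≡ true → colour c u w ≢ α
      α-missing = proj₂ leafColour

      colour′ : V → V → Fin K
      colour′ x y = if ⌊ x ≟ᶠ v ⌋ ∨ ⌊ y ≟ᶠ v ⌋ then α else colour c x y

      colour′-fromLeaf : ∀ y → colour′ v y ≡ α
      colour′-fromLeaf y with v ≟ᶠ v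
      ... | yes _   = refl
      ... | no  v≢v = contradiction refl v≢v

      colour′-toLeaf : ∀ x → colour′ x v ≡ α
      colour′-toLeaf x with x ≟ᶠ v | v ≟ᶠ v
      ... | yes _ | _       = refl
      ... | no  _ | yes _   = refl
      ... | no  _ | no  v≢v = contradiction refl v≢v

      colour′-away : ∀ x y → x ≢ v → y ≢ v → colour′ x y ≡ colour c x y
      colour′-away x y x≢v y≢v with x ≟ᶠ v | y ≟ᶠ v
      ... | yes x≡v | _       = contradiction x≡v x≢v
      ... | no  _   | yes y≡v = contradiction y≡v y≢v
      ... | no  _   | no  _   = refl

      isLeaf? : ∀ x → x ≡ v ⊎ x ≢ v
      isLeaf? x with x ≟ᶠ v
      ... | yes x≡v = inj₁ x≡v
      ... | no  x≢v = inj₂ x≢v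

      sym′ : ∀ x y → S x ≡ true → S y ≡ true → adj G x y ≡ true → colour′ x y ≡ colour′ y x
      sym′ x y Sx Sy xy with isLeaf? x | isLeaf? y
      ... | inj₁ refl | _        = trans (colour′-fromLeaf y) (sym (colour′-toLeaf y))
      ... | inj₂ _    | inj₁ refl = trans (colour′-toLeaf x) (sym (colour′-fromLeaf x))
      ... | inj₂ x≢v  | inj₂ y≢v  = trans (colour′-away x y x≢v y≢v)
          (trans (colour-sym c x y (S′-keeps x Sx x≢v) (S′-keeps y Sy y≢v) xy) (sym (colour′-away y x y≢v x≢v)))

      proper′ : ∀ x y z → S x ≡ true → S y ≡ true → S z ≡ true → adj G x y ≡ true → adj G x z ≡ true →
                y ≢ z → colour′ x y ≢ colour′ x z
      proper′ x y z Sx Sy Sz xy xz y≢z with isLeaf? x | isLeaf? y | isLeaf? z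
      ... | inj₁ refl | _         | _         = contradiction (leaf-neighbour-unique Sy Sz xy xz) (y≢z ∘ sym)
      ... | inj₂ _    | inj₁ refl | inj₁ refl = contradiction refl y≢z
      ... | inj₂ x≢v  | inj₁ refl | inj₂ z≢v  = λ eq → α-missing x z Sx (adj-sym G xy) (S′-keeps z Sz z≢v) xz
          (sym (trans (sym (colour′-toLeaf x)) (trans eq (colour′-away x z x≢v z≢v))))
      ... | inj₂ x≢v  | inj₂ y≢v  | inj₁ refl = λ eq → α-missing x y Sx (adj-sym G xz) (S′-keeps y Sy y≢v) xy
          (trans (sym (colour′-away x y x≢v y≢v)) (trans eq (colour′-toLeaf x)))
      ... | inj₂ x≢v  | inj₂ y≢v  | inj₂ z≢v  = λ eq → colour-proper c x y z
          (S′-keeps x Sx x≢v) (S′-keeps y Sy y≢v) (S′-keeps z Sz z≢v) xy xz y≢z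
          (trans (sym (colour′-away x y x≢v y≢v)) (trans eq (colour′-away x z x≢v z≢v)))

      -- a cycle through v would give v two neighbours
      leaf-∉-cycle : ∀ vs → IsCycle G vs → All (λ w → S w ≡ true) vs → v ∉ vs
      leaf-∉-cycle vs cyc inS v∈ with s , p , Ss , Sp , v~s , v~p , s≢p , _ ← cycleNeighboursIn vs cyc inS v∈ =
        s≢p (sym (leaf-neighbour-unique Ss Sp v~s v~p))

      cycles′ : ∀ vs → IsCycle G vs → All (λ w → S w ≡ true) vs → r ≤ coloursOn colour′ vs
      cycles′ vs cyc inS = subst (r ≤_) (coloursOn-cong vs λ x∈ y∈ → sym (colour′-away _ _ (≢v x∈) (≢v y∈)))
        (colourful-cycles c vs cyc (All.tabulate λ {w} w∈ → S′-keeps w (All.lookup inS w∈) (≢v w∈)))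
        where
        ≢v : ∀ {w} → w ∈ vs → w ≢ v
        ≢v w∈ refl = leaf-∉-cycle vs cyc inS w∈

    colouring-removeLeaf : Colouring S
    colouring-removeLeaf = record
      { colour = colour′ ; colour-sym = sym′ ; colour-proper = proper′ ; colourful-cycles = cycles′ }

  module _ {S : VSet G} {x y : V} {mid : List V} (ear : IsStrictEar G S x mid y) (r≤l : r ≤ length mid)
           (c : Colouring (removeL {G} S mid)) where

    private
      l : ℕ
      l = length mid

      S′ : VSet G
      S′ = removeL {G} S mid

      ps : List V
      ps = x ∷ (mid ++ [ y ])

      -- the ear as the vertex sequence P 0 = x, P 1, …, P l, P (suc l) = y
      P : ℕ → V
      P = nth x ps

      length-ps : length ps ≡ suc (suc l)
      length-ps = cong suc (trans (length-++ mid) (+-comm l 1))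

      bounded : ∀ {i} → i ≤ suc l → i < length ps
      bounded {i} i≤ = subst (i <_) (sym length-ps) (s≤s i≤)

      P-injective : ∀ {i j} → i ≤ suc l → j ≤ suc l → P i ≡ P j → i ≡ j
      P-injective i≤ j≤ = nth-injective x ps (proj₁ ear) (bounded i≤) (bounded j≤)

      P-inS : ∀ {i} → i ≤ suc l → S (P i) ≡ true
      P-inS i≤ = All.lookup (proj₁ (proj₂ ear)) (nth-∈ x ps (bounded i≤))

      P-adj : ∀ {i} → i ≤ l → adj G (P i) (P (suc i)) ≡ true
      P-adj i≤ = nth-consecPairs {R = IsEdge G} x ps (proj₁ (proj₂ (proj₂ ear))) (bounded (s≤s i≤))

      P-inner : ∀ {j} → j < l → P (suc j) ≡ nth x mid j
      P-inner = nth-++ˡ x mid [ y ]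

      P-last : P (suc l) ≡ y
      P-last = nth-++-length x mid y

      P-inner-∈ : ∀ {j} → j < l → P (suc j) ∈ mid
      P-inner-∈ j< = subst (_∈ mid) (sym (P-inner j<)) (nth-∈ x mid j<)

      ∈-mid : ∀ {u} → u ∈ mid → ∃[ j ] (j < l × P (suc j) ≡ u)
      ∈-mid u∈ with j , j< , eq ← ∈⇒nth x mid u∈ = j , j< , trans (P-inner j<) eq

      inner-neighbours : ∀ {j w} → j < l → S w ≡ true → adj G (P (suc j)) w ≡ true → w ≡ P j ⊎ w ≡ P (suc (suc j))
      inner-neighbours {j} {w} j< Sw uw = pair-∈ (∈-saturated-neighbours G S (P (suc j)) !ends ends⊆ deg≤2 Sw uw)
        where
        pair-∈ : w ∈ P j ∷ P (suc (suc j)) ∷ [] → w ≡ P j ⊎ w ≡ P (suc (suc j))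
        pair-∈ (here w≡)         = inj₁ w≡
        pair-∈ (there (here w≡)) = inj₂ w≡
        j≤ : j ≤ suc l
        j≤ = ≤-trans (<⇒≤ j<) (n≤1+n l)
        !ends : Unique (P j ∷ P (suc (suc j)) ∷ [])
        !ends = ((<⇒≢ (m<n⇒m<1+n (n<1+n j)) ∘ P-injective j≤ (s≤s j<)) ∷ []) ∷ [] ∷ []
        ends⊆ : P j ∷ P (suc (suc j)) ∷ [] ⊆ neighbours G S (P (suc j))
        ends⊆ (here refl)         = ∈-neighbours⁺ G S _ (P-inS j≤) (adj-sym G (P-adj (<⇒≤ j<)))
        ends⊆ (there (here refl)) = ∈-neighbours⁺ G S _ (P-inS (s≤s j<)) (P-adj j<)
        deg≤2 : degIn G S (P (suc j)) ≤ 2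
        deg≤2 = ≤-reflexive (subst (λ u → degIn G S u ≡ 2) (sym (P-inner j<))
                                   (All.lookup (proj₂ (proj₂ (proj₂ ear))) (nth-∈ x mid j<)))

      L : ℕ
      L = suc l

      0<l : 0 < l
      0<l = ≤-trans (s≤s z≤n) (≤-trans 3≤r r≤l)

      suc-pred-l : suc (l ∸ 1) ≡ l
      suc-pred-l = m+[n∸m]≡n 0<l

      EarEdge : ℕ → V → V → Set
      EarEdge i u v = (P i ≡ u × P (suc i) ≡ v) ⊎ (P i ≡ v × P (suc i) ≡ u)

      OnEar : V → V → Set
      OnEar u v = ∃[ i ] (i < L × EarEdge i u v)

      earEdge? : ∀ u v → Dec (OnEar u v)
      earEdge? u v = anyUpTo? (λ i → ((P i ≟ᶠ u) ×-dec (P (suc i) ≟ᶠ v)) ⊎-dec ((P i ≟ᶠ v) ×-dec (P (suc i) ≟ᶠ u))) L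

      earEdge-sym : ∀ {i u v} → EarEdge i u v → EarEdge i v u
      earEdge-sym (inj₁ e) = inj₂ e
      earEdge-sym (inj₂ e) = inj₁ e

      ear-no-reversal : ∀ {i j} → i < L → j < L → P i ≡ P (suc j) → P (suc i) ≡ P j → ⊥
      ear-no-reversal {i} i< j< eq eq′ =
        <⇒≢ (m<n⇒m<1+n (n<1+n i)) (trans (P-injective (<⇒≤ i<) j< eq) (cong suc (sym (P-injective i< (<⇒≤ j<) eq′))))

      earEdge-index-unique : ∀ {i j u v} → i < L → j < L → EarEdge i u v → EarEdge j u v → i ≡ j
      earEdge-index-unique i< j< (inj₁ (eq , _)) (inj₁ (eq′ , _)) = P-injective (<⇒≤ i<) (<⇒≤ j<) (trans eq (sym eq′))
      earEdge-index-unique i< j< (inj₂ (eq , _)) (inj₂ (eq′ , _)) = P-injective (<⇒≤ i<) (<⇒≤ j<) (trans eq (sym eq′))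
      earEdge-index-unique i< j< (inj₁ (eq₁ , eq₂)) (inj₂ (eq₁′ , eq₂′)) =
        ⊥-elim (ear-no-reversal i< j< (trans eq₁ (sym eq₂′)) (trans eq₂ (sym eq₁′)))
      earEdge-index-unique i< j< (inj₂ (eq₁ , eq₂)) (inj₁ (eq₁′ , eq₂′)) =
        ⊥-elim (ear-no-reversal i< j< (trans eq₁ (sym eq₂′)) (trans eq₂ (sym eq₁′)))

      earEdge-functional : ∀ {i u v w} → i < L → EarEdge i u v → EarEdge i u w → v ≡ w
      earEdge-functional i< (inj₁ (_ , eq)) (inj₁ (_ , eq′)) = trans (sym eq) eq′
      earEdge-functional i< (inj₂ (eq , _)) (inj₂ (eq′ , _)) = trans (sym eq) eq′
      earEdge-functional {i} i< (inj₁ (eq , _)) (inj₂ (_ , eq′)) =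
        contradiction (P-injective (<⇒≤ i<) i< (trans eq (sym eq′))) (<⇒≢ (n<1+n i))
      earEdge-functional {i} i< (inj₂ (_ , eq)) (inj₁ (eq′ , _)) =
        contradiction (P-injective (<⇒≤ i<) i< (trans eq′ (sym eq))) (<⇒≢ (n<1+n i))

      earEdge-start : ∀ {i u v} → EarEdge i u v → P i ≡ u ⊎ P (suc i) ≡ u
      earEdge-start (inj₁ (eq , _)) = inj₁ eq
      earEdge-start (inj₂ (_ , eq)) = inj₂ eq

      earEdges-consecutive : ∀ {i j u v w} → i < L → j < L → EarEdge i u v → EarEdge j u w → v ≢ w →
                             j ≡ suc i ⊎ i ≡ suc j
      earEdges-consecutive i< j< e e′ v≢w with earEdge-start e | earEdge-start e′
      ... | inj₁ eq | inj₁ eq′ with refl ← P-injective (<⇒≤ i<) (<⇒≤ j<) (trans eq (sym eq′)) =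
        contradiction (earEdge-functional i< e e′) v≢w
      ... | inj₁ eq | inj₂ eq′ = inj₂ (P-injective (<⇒≤ i<) j< (trans eq (sym eq′)))
      ... | inj₂ eq | inj₁ eq′ = inj₁ (sym (P-injective i< (<⇒≤ j<) (trans eq (sym eq′))))
      ... | inj₂ eq | inj₂ eq′ with refl ← suc-injective (P-injective i< j< (trans eq (sym eq′))) =
        contradiction (earEdge-functional i< e e′) v≢w

      earEdge-from-mid : ∀ {u w} → u ∈ mid → S w ≡ true → adj G u w ≡ true → OnEar u w
      earEdge-from-mid u∈ Sw uw with j , j< , refl ← ∈-mid u∈ with inner-neighbours j< Sw uw
      ... | inj₁ w≡ = j , m<n⇒m<1+n j< , inj₂ (sym w≡ , refl)
      ... | inj₂ w≡ = suc j , s≤s j< , inj₁ (refl , sym w≡)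

      earEdge-touches-mid : ∀ {i u v} → i < L → EarEdge i u v → u ∈ mid ⊎ v ∈ mid
      earEdge-touches-mid {zero} i< (inj₁ (_ , eq)) = inj₂ (subst (_∈ mid) eq (P-inner-∈ 0<l))
      earEdge-touches-mid {zero} i< (inj₂ (_ , eq)) = inj₁ (subst (_∈ mid) eq (P-inner-∈ 0<l))
      earEdge-touches-mid {suc j} i< (inj₁ (eq , _)) = inj₁ (subst (_∈ mid) eq (P-inner-∈ (≤-pred i<)))
      earEdge-touches-mid {suc j} i< (inj₂ (eq , _)) = inj₂ (subst (_∈ mid) eq (P-inner-∈ (≤-pred i<)))

      earEdge-at-end : ∀ {i u v} → i < L → EarEdge i u v → u ∉ mid → (u ≡ x × i ≡ 0) ⊎ (u ≡ y × i ≡ l)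
      earEdge-at-end {i} i< e u∉ with earEdge-start e
      earEdge-at-end {zero}  i< e u∉ | inj₁ eq = inj₁ (sym eq , refl)
      earEdge-at-end {suc j} i< e u∉ | inj₁ eq = contradiction (subst (_∈ mid) eq (P-inner-∈ (≤-pred i<))) u∉
      earEdge-at-end {i}     i< e u∉ | inj₂ eq with m≤n⇒m<n∨m≡n (≤-pred i<)
      ... | inj₁ i<l = contradiction (subst (_∈ mid) eq (P-inner-∈ i<l)) u∉
      ... | inj₂ refl = inj₂ (trans (sym eq) P-last , refl)

      P-first-∈ : P 1 ∈ mid
      P-first-∈ = P-inner-∈ 0<l

      P-last-∈ : P l ∈ mid
      P-last-∈ = subst (λ i → P i ∈ mid) suc-pred-l (P-inner-∈ (≤-reflexive suc-pred-l))

      mid-inS : ∀ {u} → u ∈ mid → S u ≡ true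
      mid-inS u∈ with j , j< , refl ← ∈-mid u∈ = P-inS (m<n⇒m<1+n j<)

      -- x and y each lose a neighbour in mid, so a colour is missing there in G[S′]
      degree-drop : ∀ {u v} → u ∈ mid → adj G v u ≡ true → degIn G S′ v < K
      degree-drop {u} {v} u∈ vu =
        ≤-trans (degIn-removal G (removeL-⊆ {G} S mid) (mid-inS u∈) (removeL-removes {G} S mid u u∈) vu) (degIn≤K S v)

      a-missing : ∃[ a ] (∀ w → S′ w ≡ true → adj G x w ≡ true → colour c x w ≢ a)
      a-missing = missingColour G S′ (colour c) x (degree-drop P-first-∈ (P-adj z≤n))

      b-missing : ∃[ b ] (∀ w → S′ w ≡ true → adj G y w ≡ true → colour c y w ≢ b)
      b-missing = missingColour G S′ (colour c) y
        (degree-drop P-last-∈ (subst (λ u → adj G u (P l) ≡ true) P-last (adj-sym G (P-adj ≤-refl))))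

      open EarColouring (earColouring 3≤r r≤K r≤l (proj₁ a-missing) (proj₁ b-missing))
        renaming (colour to earColour; colour-first to earColour-first; colour-last to earColour-last;
                  colour-step to earColour-step)

      NotEar : V → V → Set
      NotEar u v = ¬ OnEar u v

      recolour : ∀ {u v} → Dec (OnEar u v) → Fin K → Fin K
      recolour (yes (i , _)) _   = earColour i
      recolour (no  _)       old = old

      colour′ : V → V → Fin K
      colour′ u v = recolour (earEdge? u v) (colour c u v)

      colour′-ear : ∀ {i u v} → i < L → EarEdge i u v → colour′ u v ≡ earColour i
      colour′-ear {i} {u} {v} i< e = onEar (earEdge? u v)
        where
        onEar : (d : Dec (OnEar u v)) → recolour d (colour c u v) ≡ earColour i
        onEar (yes (j , j< , e′)) = cong earColour (earEdge-index-unique j< i< e′ e)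
        onEar (no  notEar)        = contradiction (i , i< , e) notEar

      colour′-notEar : ∀ {u v} → NotEar u v → colour′ u v ≡ colour c u v
      colour′-notEar {u} {v} notEar = offEar (earEdge? u v)
        where
        offEar : (d : Dec (OnEar u v)) → recolour d (colour c u v) ≡ colour c u v
        offEar (yes ear) = contradiction ear notEar
        offEar (no  _)   = refl

      notEar-sym : ∀ {u v} → NotEar u v → NotEar v u
      notEar-sym notEar (i , i< , e) = notEar (i , i< , earEdge-sym e)

      notEar-∉ : ∀ {u v} → S v ≡ true → adj G u v ≡ true → NotEar u v → u ∉ mid
      notEar-∉ Sv uv notEar u∈ = notEar (earEdge-from-mid u∈ Sv uv)

      notEar-inS′ : ∀ {u v} → S u ≡ true → S v ≡ true → adj G u v ≡ true → NotEar u v → S′ u ≡ true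
      notEar-inS′ {u} Su Sv uv notEar = removeL-keeps {G} S mid u Su (notEar-∉ Sv uv notEar)

      notEar-inS′ʳ : ∀ {u v} → S u ≡ true → S v ≡ true → adj G u v ≡ true → NotEar u v → S′ v ≡ true
      notEar-inS′ʳ Su Sv uv notEar = notEar-inS′ Sv Su (adj-sym G uv) (notEar-sym notEar)

      sym′ : ∀ u v → S u ≡ true → S v ≡ true → adj G u v ≡ true → colour′ u v ≡ colour′ v u
      sym′ u v Su Sv uv = bySym (earEdge? u v)
        where
        bySym : Dec (OnEar u v) → colour′ u v ≡ colour′ v u
        bySym (yes (i , i< , e)) = trans (colour′-ear i< e) (sym (colour′-ear i< (earEdge-sym e)))
        bySym (no  notEar)       = trans (colour′-notEar notEar)
          (trans (colour-sym c u v (notEar-inS′ Su Sv uv notEar) (notEar-inS′ʳ Su Sv uv notEar) uv)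
                 (sym (colour′-notEar (notEar-sym notEar))))

      endColour≢ : ∀ {i u w} → (u ≡ x × i ≡ 0) ⊎ (u ≡ y × i ≡ l) → S′ w ≡ true → adj G u w ≡ true →
                   earColour i ≢ colour c u w
      endColour≢ (inj₁ (refl , refl)) S′w uw eq = proj₂ a-missing _ S′w uw (trans (sym eq) earColour-first)
      endColour≢ (inj₂ (refl , refl)) S′w uw eq = proj₂ b-missing _ S′w uw (trans (sym eq) earColour-last)

      -- an ear edge meets a non-ear edge only at x or y, where a and b are missing
      ear≢notEar : ∀ {i u v w} → i < L → EarEdge i u v → S u ≡ true → S w ≡ true → adj G u w ≡ true → NotEar u w →
                   earColour i ≢ colour c u w
      ear≢notEar i< e Su Sw uw notEar =
        endColour≢ (earEdge-at-end i< e (notEar-∉ Sw uw notEar)) (notEar-inS′ʳ Su Sw uw notEar) uw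

      proper′ : ∀ u v w → S u ≡ true → S v ≡ true → S w ≡ true → adj G u v ≡ true → adj G u w ≡ true →
                v ≢ w → colour′ u v ≢ colour′ u w
      proper′ u v w Su Sv Sw uv uw v≢w = byCases (earEdge? u v) (earEdge? u w)
        where
        consecutive≢ : ∀ {i j} → i < L → j < L → j ≡ suc i ⊎ i ≡ suc j → earColour i ≢ earColour j
        consecutive≢ i< j< (inj₁ refl) = earColour-step (≤-pred j<)
        consecutive≢ i< j< (inj₂ refl) = earColour-step (≤-pred i<) ∘ sym
        byCases : Dec (OnEar u v) → Dec (OnEar u w) → colour′ u v ≢ colour′ u w
        byCases (yes (i , i< , e)) (yes (j , j< , e′)) eq =
          consecutive≢ i< j< (earEdges-consecutive i< j< e e′ v≢w)
            (trans (sym (colour′-ear i< e)) (trans eq (colour′-ear j< e′)))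
        byCases (yes (i , i< , e)) (no notEar) eq =
          ear≢notEar i< e Su Sw uw notEar (trans (sym (colour′-ear i< e)) (trans eq (colour′-notEar notEar)))
        byCases (no notEar) (yes (j , j< , e′)) eq =
          ear≢notEar j< e′ Su Sv uv notEar (trans (sym (colour′-ear j< e′)) (trans (sym eq) (colour′-notEar notEar)))
        byCases (no notEar) (no notEar′) eq =
          colour-proper c u v w (notEar-inS′ Su Sv uv notEar) (notEar-inS′ʳ Su Sv uv notEar)
            (notEar-inS′ʳ Su Sw uw notEar′) uv uw v≢w
            (trans (sym (colour′-notEar notEar)) (trans eq (colour′-notEar notEar′)))

      module _ (vs : List V) (cyc : IsCycle G vs) (inS : All (λ w → S w ≡ true) vs) where

        CycleEdge : V → V → Set
        CycleEdge u v = (u , v) ∈ cyclePairs vs ⊎ (v , u) ∈ cyclePairs vs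

        cycleEdge-sym : ∀ {u v} → CycleEdge u v → CycleEdge v u
        cycleEdge-sym (inj₁ uv∈) = inj₂ uv∈
        cycleEdge-sym (inj₂ vu∈) = inj₁ vu∈

        cycleEdge-∈ : ∀ {u v} → CycleEdge u v → v ∈ vs
        cycleEdge-∈ (inj₁ uv∈) = proj₂ (cyclePairs-∈⁻ vs uv∈)
        cycleEdge-∈ (inj₂ vu∈) = proj₁ (cyclePairs-∈⁻ vs vu∈)

        inner-on-cycle : ∀ {j} → j < l → P (suc j) ∈ vs →
                         CycleEdge (P (suc j)) (P j) × CycleEdge (P (suc j)) (P (suc (suc j)))
        inner-on-cycle j< u∈ with s , p , Ss , Sp , us , up , s≢p , us∈ , pu∈ ← cycleNeighboursIn vs cyc inS u∈
                               with inner-neighbours j< Ss us | inner-neighbours j< Sp up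
        ... | inj₁ refl | inj₂ refl = inj₁ us∈ , inj₂ pu∈
        ... | inj₂ refl | inj₁ refl = inj₂ pu∈ , inj₁ us∈
        ... | inj₁ refl | inj₁ refl = contradiction refl s≢p
        ... | inj₂ refl | inj₂ refl = contradiction refl s≢p

        P1-on-cycle : ∀ j → j < l → P (suc j) ∈ vs → P 1 ∈ vs
        P1-on-cycle zero    _   u∈ = u∈
        P1-on-cycle (suc j) sj< u∈ =
          P1-on-cycle j (<⇒≤ sj<) (cycleEdge-∈ (proj₁ (inner-on-cycle sj< u∈)))

        all-inner-on-cycle : P 1 ∈ vs → ∀ j → j < l → P (suc j) ∈ vs
        all-inner-on-cycle P1∈ zero    _   = P1∈
        all-inner-on-cycle P1∈ (suc j) sj< =
          cycleEdge-∈ (proj₂ (inner-on-cycle (<⇒≤ sj<) (all-inner-on-cycle P1∈ j (<⇒≤ sj<))))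

        ear-on-cycle : P 1 ∈ vs → ∀ {i} → i < L → CycleEdge (P i) (P (suc i))
        ear-on-cycle P1∈ {zero}  _   = cycleEdge-sym (proj₁ (inner-on-cycle 0<l P1∈))
        ear-on-cycle P1∈ {suc j} sj< = proj₂ (inner-on-cycle (≤-pred sj<) (all-inner-on-cycle P1∈ j (≤-pred sj<)))

        earColour-on-cycle : P 1 ∈ vs → ∀ {i} → i < L → earColour i ∈ edgeColours colour′ vs
        earColour-on-cycle P1∈ {i} i< = onCycle (ear-on-cycle P1∈ i<)
          where
          f : V × V → Fin K
          f e = colour′ (proj₁ e) (proj₂ e)
          onCycle : CycleEdge (P i) (P (suc i)) → earColour i ∈ edgeColours colour′ vs
          onCycle (inj₁ e∈) = subst (_∈ edgeColours colour′ vs)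
                                (colour′-ear {i} {P i} {P (suc i)} i< (inj₁ (refl , refl))) (∈-map⁺ f e∈)
          onCycle (inj₂ e∈) = subst (_∈ edgeColours colour′ vs)
                                (colour′-ear {i} {P (suc i)} {P i} i< (inj₂ (refl , refl))) (∈-map⁺ f e∈)

        colours-through-mid : ∀ {u} → u ∈ vs → u ∈ mid → r ≤ coloursOn colour′ vs
        colours-through-mid {u} u∈vs u∈mid =
          subst (_≤ coloursOn colour′ vs) palette-length
            (unique⊆edgeColours⇒≤coloursOn colour′ vs palette-unique palette⊆)
          where
          P1∈ : P 1 ∈ vs
          P1∈ = let j , j< , eq = ∈-mid u∈mid in P1-on-cycle j j< (subst (_∈ vs) (sym eq) u∈vs)
          palette⊆ : palette ⊆ edgeColours colour′ vs
          palette⊆ {a} a∈ = let i , i≤l , eq = All.lookup palette-used a∈ in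
            subst (_∈ edgeColours colour′ vs) eq (earColour-on-cycle P1∈ (s≤s i≤l))

        colours-avoiding-mid : (∀ {u} → u ∈ vs → u ∉ mid) → r ≤ coloursOn colour′ vs
        colours-avoiding-mid avoids = subst (r ≤_) (coloursOn-cong vs agree)
            (colourful-cycles c vs cyc
              (All.tabulate λ {w} w∈ → removeL-keeps {G} S mid w (All.lookup inS w∈) (avoids w∈)))
          where
          agree : ∀ {a b} → a ∈ vs → b ∈ vs → colour c a b ≡ colour′ a b
          agree a∈ b∈ = sym (colour′-notEar λ (i , i< , e) → [ avoids a∈ , avoids b∈ ]′ (earEdge-touches-mid i< e))

        cycles′ : r ≤ coloursOn colour′ vs
        cycles′ with Any.any? (λ u → DecMembership._∈?_ _≟ᶠ_ u mid) vs
        ... | yes some = let u , u∈vs , u∈mid = find some in colours-through-mid u∈vs u∈mid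
        ... | no  none = colours-avoiding-mid λ u∈vs u∈mid → none (Any.map (λ { refl → u∈mid }) u∈vs)

    colouring-removeEar : Colouring S
    colouring-removeEar = record
      { colour = colour′ ; colour-sym = sym′ ; colour-proper = proper′ ; colourful-cycles = cycles′ }

  colouring : ∀ {S} → Reduces G (r + 1) S → Colouring S
  colouring (done S≡∅)                               = colouring-empty S≡∅
  colouring (step (del-low v Sv deg≤1) rest)         = colouring-removeLeaf v Sv deg≤1 (colouring rest)
  colouring (step (del-ear x mid y ear r+1≤) rest)   =
    colouring-removeEar ear (≤-pred (subst (_≤ suc (length mid)) (+-comm r 1) r+1≤)) (colouring rest)

-- The r-acyclic chromatic index

module PathDegenerateColouring (G : Graph) {r : ℕ} (3≤r : 3 ≤ r) (degenerate : PathDegenerate (r + 1) G) where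

  rAcyclicColourable : ∀ {K} → maxDeg G ≤ K → r ≤ K → RAcyclicColourable r G K
  rAcyclicColourable {K} Δ≤K r≤K = subst (RAcyclicColourable r G) 3+k≡K (edgeColouring , rAcyclic)
    where
    3+k≡K : 3 + (K ∸ 3) ≡ K
    3+k≡K = m+[n∸m]≡n (≤-trans 3≤r r≤K)
    open ReductionColouring G 3≤r (subst (maxDeg G ≤_) (sym 3+k≡K) Δ≤K) (subst (r ≤_) (sym 3+k≡K) r≤K)
      using (Colouring; colouring; colour; colour-sym; colour-proper; colourful-cycles)
    c : Colouring (λ _ → true)
    c = colouring degenerate
    edgeColouring : ProperEdgeColouring G (3 + (K ∸ 3))
    edgeColouring = record
      { col     = colour c
      ; col-sym = λ u v uv → colour-sym c u v refl refl uv
      ; proper  = λ u v w uv uw v≢w → colour-proper c u v w refl refl refl uv uw v≢w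
      }
    rAcyclic : IsRAcyclic r edgeColouring
    rAcyclic vs cyc = ≤-trans (m⊓n≤n (length vs) r) (colourful-cycles c vs cyc (All.tabulate λ _ → refl))

  cycle-length≥ : ∀ vs → IsCycle G vs → r ≤ length vs
  cycle-length≥ vs cyc = ≤-trans (colourful-cycles c vs cyc (All.tabulate λ _ → refl)) (coloursOn≤length (colour c) vs)
    where
    open ReductionColouring G {k = maxDeg G ⊔ r} 3≤r (≤-trans (m≤m⊔n (maxDeg G) r) (m≤n+m _ 3))
                                                    (≤-trans (m≤n⊔m (maxDeg G) r) (m≤n+m _ 3))
      using (Colouring; colouring; colour; colourful-cycles)
    c : Colouring (λ _ → true)
    c = colouring degenerate

maxDeg≤colours : (G : Graph) {r k : ℕ} → RAcyclicColourable r G k → maxDeg G ≤ k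
maxDeg≤colours G (c , _) = ≮⇒≥ λ k<Δ →
  let v , k<deg = maxDeg-attained G k<Δ in <⇒≱ k<deg (deg≤colours G c v)

cycle⇒r≤colours : (G : Graph) {r k : ℕ} → RAcyclicColourable r G k →
                  ∀ {vs} → IsCycle G vs → r ≤ length vs → r ≤ k
cycle⇒r≤colours G {r} {k} (c , rAcyclic) {vs} cyc r≤len = begin
  r                       ≡⟨ m≥n⇒m⊓n≡n r≤len ⟨
  length vs ⊓ r           ≤⟨ rAcyclic vs cyc ⟩
  coloursOnCycle c vs     ≤⟨ coloursOn≤colours (col c) vs ⟩
  k                       ∎
  where open ≤-Reasoning

-- The expansion hypothesis is what yields g in the paper; here g is given.
mainTheorem7 : (r : ℕ) → 3 ≤ r → (C : GraphClass) → SubExponentialExpansion C →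
    (g : ℕ → ℕ) → (∀ p G → C G → GirthAtLeast G (g p) → PathDegenerate p G) →
    ∀ G → C G → GirthAtLeast G (g (r + 1)) → ¬ IsForest G →
    AcyclicIndexIs r G (maxDeg G ⊔ r)
mainTheorem7 r 3≤r _ _ _ degenerate G G∈C girth notForest =
    rAcyclicColourable (m≤m⊔n (maxDeg G) r) (m≤n⊔m (maxDeg G) r)
  , λ k k<K colourable → notForest λ vs cyc →
      <⇒≱ k<K (⊔-lub (maxDeg≤colours G colourable) (cycle⇒r≤colours G colourable cyc (cycle-length≥ vs cyc)))
  where open PathDegenerateColouring G 3≤r (degenerate (r + 1) G G∈C girth)
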